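{- If $c\in[0,1]$ is such that Algorithm 1 with parameter $c$ is well defined (i.e., $\alpha_e\le 1$ for every edge $e$) on every bipartite graph, every fractional matching and every arrival order, then $c\le 0.382$. That is, Algorithm 1 is no more than $0.382$-selectable for bipartite graphs.
   Context: A fractional matching of $G=(V,E)$ is $\bm{x}\in[0,1]^E$ with $\sum_{e\ni v}x_e\le1$ for every vertex $v$. Each edge $e$ is active independently with probability $x_e$. Edges arrive one at a time in an order fixed in advance by an oblivious adversary. An arriving edge $e=(u,v)$ is blocked if an already-selected edge is incident to $u$ or $v$. Algorithm 1 with parameter $c$ (the OCRS of Ezra et al.): for each arriving edge $e$, let $\alpha_e:=c/\mathbb{P}[e\text{ not blocked}]$ (probability over activeness of earlier edges and the algorithm's earlier randomness), draw independent $A_e\sim\mathrm{Ber}(\alpha_e)$, and select $e$ iff $e$ is active, not blocked and $A_e=1$. It is well defined only if every $\alpha_e\le 1$, in which case each edge is selected with probability exactly $cx_e$.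
   Formalization: The parameter c is a rational number in [0,1], and the fractional matchings in the hypothesis take values in ℚ. -}

module Defs where

open import Data.Nat using (ℕ)
open import Data.Fin using (Fin; _≟_)
open import Data.Bool using (Bool; true; false; not; _∧_; _∨_; if_then_else_)
open import Data.Product using (_×_; _,_; Σ; proj₁)
open import Data.List using (List; []; _∷_; map)
open import Data.List.Relation.Unary.All using (All)
open import Data.List.Relation.Unary.Unique.Propositional using (Unique)
open import Data.Unit using (⊤)
open import Data.Rational using (ℚ; 0ℚ; 1ℚ; _+_; _*_; _-_; _÷_; _≤_; Positive)
open import Data.Rational.Properties using (pos⇒nonZero)
open import Relation.Nullary.Decidable using (⌊_⌋)

-- A bipartite graph with sides Fin m and Fin n, together with a fractional
-- vector x and an arrival order, is given as a list of (edge , x_e) in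
-- arrival order.
Edge : ℕ → ℕ → Set
Edge m n = Fin m × Fin n

Instance : ℕ → ℕ → Set
Instance m n = List (Edge m n × ℚ)

Simple : ∀ {m n} → Instance m n → Set
Simple es = Unique (map proj₁ es)

loadL : ∀ {m n} → Instance m n → Fin m → ℚ
loadL [] u = 0ℚ
loadL (((a , b) , x) ∷ es) u = (if ⌊ a ≟ u ⌋ then x else 0ℚ) + loadL es u

loadR : ∀ {m n} → Instance m n → Fin n → ℚ
loadR [] v = 0ℚ
loadR (((a , b) , x) ∷ es) v = (if ⌊ b ≟ v ⌋ then x else 0ℚ) + loadR es v

FractionalMatching : ∀ {m n} → Instance m n → Set
FractionalMatching {m} {n} es =
  All (λ ex → (0ℚ ≤ Data.Product.proj₂ ex) × (Data.Product.proj₂ ex ≤ 1ℚ)) es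
  × ((u : Fin m) → loadL es u ≤ 1ℚ)
  × ((v : Fin n) → loadR es v ≤ 1ℚ)

-- State of the process: the sets of left / right vertices already covered
-- by a selected edge.
State : ℕ → ℕ → Set
State m n = (Fin m → Bool) × (Fin n → Bool)

-- A (finitely supported) probability distribution over states: weighted list.
Dist : ℕ → ℕ → Set
Dist m n = List (ℚ × State m n)

initial : ∀ {m n} → Dist m n
initial = (1ℚ , ((λ _ → false) , (λ _ → false))) ∷ []

free : ∀ {m n} → State m n → Edge m n → Bool
free (L , R) (u , v) = not (L u) ∧ not (R v)

probFree : ∀ {m n} → Dist m n → Edge m n → ℚ
probFree [] e = 0ℚ
probFree ((w , s) ∷ d) e = (if free s e then w else 0ℚ) + probFree d e

mark : ∀ {m n} → State m n → Edge m n → State m n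
mark (L , R) (u , v) = ((λ i → L i ∨ ⌊ i ≟ u ⌋) , (λ j → R j ∨ ⌊ j ≟ v ⌋))

-- process edge e, which (given not blocked) is selected with probability
-- β = x_e · α_e  (active with prob. x_e, independently A_e = 1 with prob. α_e)
step : ∀ {m n} → ℚ → Dist m n → Edge m n → Dist m n
step β [] e = []
step β ((w , s) ∷ d) e with free s e
... | true  = (w * β , mark s e) ∷ (w * (1ℚ - β) , s) ∷ step β d e
... | false = (w , s) ∷ step β d e

-- Algorithm 1 with parameter c is well defined on the remaining edges, starting
-- from distribution d: at each arriving edge e, α_e = c / P[e not blocked]
-- is defined (P[e not blocked] > 0) and α_e ≤ 1.
WellDefinedFrom : ∀ {m n} → ℚ → Instance m n → Dist m n → Set
WellDefinedFrom c [] d = ⊤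
WellDefinedFrom c ((e , x) ∷ es) d =
  Σ (Positive (probFree d e)) λ pos →
    let α = _÷_ c (probFree d e) {{pos⇒nonZero (probFree d e) {{pos}}}} in
    (α ≤ 1ℚ) × WellDefinedFrom c es (step (x * α) d e)

WellDefined : ∀ {m n} → ℚ → Instance m n → Set
WellDefined c es = WellDefinedFrom c es initial

{-# OPTIONS --safe #-}
module Submission where

-- Take the path v₀ – u₀ – v₁ – u₁ in which the outer edges u₀v₀ and u₁v₁ carry
-- x = 1 and arrive first, and the middle edge u₀v₁ carries x = 0 and arrives last.
-- Each outer edge is free with probability 1, so it is selected with probability
-- c, independently of the other; the middle edge is therefore free with
-- probability (1 − c)², and α ≤ 1 for it says c ≤ (1 − c)².  This forces
-- c ≤ (3 − √5)/2 ≈ 0.38197.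

open import Defs
open import Data.Nat using (ℕ)
open import Data.Integer using (+_)
open import Data.Rational using (ℚ; 0ℚ; 1ℚ; _≤_; _/_)
open import Data.Rational
  using (_*_; _-_; _÷_; 1/_; _<_; Positive; NonNegative; NonZero; nonNegative)
open import Data.Rational.Properties
open import Data.Rational.Solver using (module +-*-Solver)
open +-*-Solver using (solve; con; _:+_; _:-_; _:*_; _:=_)
open import Data.Fin using (zero; suc)
open import Data.Product using (_,_)
open import Data.List using (_∷_; [])
open import Data.List.Relation.Unary.All using (_∷_; [])
open import Data.List.Relation.Unary.AllPairs using (_∷_; [])
open import Relation.Nullary.Decidable using (toWitness)
open import Relation.Binary.PropositionalEquality

q≡1⇒p÷q≡p : ∀ p {q} .{{_ : NonZero q}} → q ≡ 1ℚ → p ÷ q ≡ p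
q≡1⇒p÷q≡p p refl = *-identityʳ p

÷≤1⇒≤ : ∀ p q .{{_ : Positive q}} → (p ÷ q) {{pos⇒nonZero q}} ≤ 1ℚ → p ≤ q
÷≤1⇒≤ p q p÷q≤1 = subst₂ _≤_ p÷q*q≡p (*-identityˡ q)
  (*-monoʳ-≤-nonNeg q {{pos⇒nonNeg q}} p÷q≤1)
  where
  instance
    q≢0 : NonZero q
    q≢0 = pos⇒nonZero q
  p÷q*q≡p : (p ÷ q) * q ≡ p
  p÷q*q≡p = begin
    (p ÷ q) * q     ≡⟨ *-assoc p _ q ⟩
    p * (1/ q * q)  ≡⟨ cong (p *_) (*-inverseˡ q) ⟩
    p * 1ℚ          ≡⟨ *-identityʳ p ⟩
    p               ∎
    where open ≡-Reasoning

c≤[1-c]²⇒c≤0·382 : ∀ c → c ≤ 1ℚ → c ≤ (1ℚ - c) * (1ℚ - c) → c ≤ (+ 382) / 1000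
c≤[1-c]²⇒c≤0·382 c c≤1 c≤[1-c]² =
  ≮⇒≥ λ 0·382<c → <-irrefl refl (<-≤-trans ([1-c]²<c 0·382<c) c≤[1-c]²)
  where
  open ≤-Reasoning
  0·618 : ℚ
  0·618 = (+ 618) / 1000
  instance
    0≤1-c : NonNegative (1ℚ - c)
    0≤1-c = nonNegative (+-monoʳ-≤ 1ℚ (neg-antimono-≤ c≤1))
  [1-c]²<c : (+ 382) / 1000 < c → (1ℚ - c) * (1ℚ - c) < c
  [1-c]²<c 0·382<c = begin-strict
    (1ℚ - c) * (1ℚ - c)  ≤⟨ *-monoˡ-≤-nonNeg (1ℚ - c) 1-c≤0·618 ⟩
    (1ℚ - c) * 0·618     ≤⟨ *-monoʳ-≤-nonNeg 0·618 1-c≤0·618 ⟩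
    0·618 * 0·618        <⟨ toWitness {a? = (0·618 * 0·618) <? ((+ 382) / 1000)} _ ⟩
    (+ 382) / 1000       <⟨ 0·382<c ⟩
    c                    ∎
    where
    1-c≤0·618 : 1ℚ - c ≤ 0·618
    1-c≤0·618 = <⇒≤ (+-monoʳ-< 1ℚ (neg-antimono-< 0·382<c))

e₁ e₂ e₃ : Edge 2 2
e₁ = zero , zero
e₂ = suc zero , suc zero
e₃ = zero , suc zero

path₃ : Instance 2 2
path₃ = (e₁ , 1ℚ) ∷ (e₂ , 1ℚ) ∷ (e₃ , 0ℚ) ∷ []

path₃-simple : Simple path₃
path₃-simple = ((λ ()) ∷ (λ ()) ∷ []) ∷ ((λ ()) ∷ []) ∷ [] ∷ []

path₃-fractionalMatching : FractionalMatching path₃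
path₃-fractionalMatching =
  ((0≤1 , ≤-refl) ∷ (0≤1 , ≤-refl) ∷ (≤-refl , 0≤1) ∷ [])
  , (λ { zero → ≤-refl ; (suc zero) → ≤-refl })
  , (λ { zero → ≤-refl ; (suc zero) → ≤-refl })
  where
  0≤1 : 0ℚ ≤ 1ℚ
  0≤1 = toWitness {a? = 0ℚ ≤? 1ℚ} _

-- The left-hand sides are probFree unfolded on the concrete states.
probFree-e₂≡1 : ∀ β₁ → probFree (step β₁ initial e₁) e₂ ≡ 1ℚ
probFree-e₂≡1 = solve 1 (λ β₁ → con 1ℚ :* β₁ :+ (con 1ℚ :* (con 1ℚ :- β₁) :+ con 0ℚ)
                                := con 1ℚ) refl

probFree-e₃≡[1-β₁][1-β₂] : ∀ β₁ β₂ →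
  probFree (step β₂ (step β₁ initial e₁) e₂) e₃ ≡ (1ℚ - β₁) * (1ℚ - β₂)
probFree-e₃≡[1-β₁][1-β₂] = solve 2 (λ β₁ β₂ →
  con 0ℚ :+ (con 0ℚ :+ (con 0ℚ :+ (con 1ℚ :* (con 1ℚ :- β₁) :* (con 1ℚ :- β₂) :+ con 0ℚ)))
  := (con 1ℚ :- β₁) :* (con 1ℚ :- β₂)) refl

proposition5 : (c : ℚ) → 0ℚ ≤ c → c ≤ 1ℚ →
    ((m n : ℕ) (es : Instance m n) → Simple es → FractionalMatching es →
      WellDefined c es) →
    c ≤ (+ 382) / 1000
proposition5 c _ c≤1 wellDefined
  with wellDefined 2 2 path₃ path₃-simple path₃-fractionalMatching
... | e₁-free , _ , e₂-free , _ , e₃-free , α₃≤1 , _ =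
  c≤[1-c]²⇒c≤0·382 c c≤1 (subst (c ≤_) q₃≡[1-c]² (÷≤1⇒≤ c q₃ {{e₃-free}} α₃≤1))
  where
  selectionProb : ∀ q → Positive q → ℚ
  selectionProb q q>0 = 1ℚ * (c ÷ q) {{pos⇒nonZero q {{q>0}}}}

  selectionProb≡c : ∀ q (q>0 : Positive q) → q ≡ 1ℚ → selectionProb q q>0 ≡ c
  selectionProb≡c q q>0 q≡1 =
    trans (*-identityˡ _) (q≡1⇒p÷q≡p c {{pos⇒nonZero q {{q>0}}}} q≡1)

  β₁ β₂ q₃ : ℚ
  β₁ = selectionProb (probFree initial e₁) e₁-free
  β₂ = selectionProb (probFree (step β₁ initial e₁) e₂) e₂-free
  q₃ = probFree (step β₂ (step β₁ initial e₁) e₂) e₃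

  q₃≡[1-c]² : q₃ ≡ (1ℚ - c) * (1ℚ - c)
  q₃≡[1-c]² = begin
    q₃                     ≡⟨ probFree-e₃≡[1-β₁][1-β₂] β₁ β₂ ⟩
    (1ℚ - β₁) * (1ℚ - β₂)  ≡⟨ cong₂ (λ a b → (1ℚ - a) * (1ℚ - b))
                                 (selectionProb≡c _ e₁-free refl)
                                 (selectionProb≡c _ e₂-free (probFree-e₂≡1 β₁)) ⟩
    (1ℚ - c) * (1ℚ - c)    ∎
    where open ≡-Reasoning
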